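{- Let $\mathbf A=(A,\le,0,1)$ be a bounded MLUB-complete poset, $T$ a nonempty set, and $P,F,H,G:\mathcal P_+(A^T)\to(\mathcal P_+A)^T$ arbitrary maps (tense operators on $\mathbf A$). Let $R^*$ be the relation induced by $P,F,H,G$ and suppose $R^*$ is serial. Let $P^*,F^*,H^*,G^*$ be the tense operators on $\mathbf A$ induced by the time frame $(T,R^*)$. Then for every $B\in\mathcal P_+(A^T)$: $P^*(B)\le_2 P(B)$, $F^*(B)\le_2F(B)$, $H(B)\le_1H^*(B)$ and $G(B)\le_1 G^*(B)$.
   Context: For a poset and $X\subseteq A$: $L(X)$, $U(X)$ are the sets of lower/upper bounds of $X$; $\operatorname{Max}X,\operatorname{Min}X$ the sets of maximal/minimal elements. MLUB-complete: for every nonempty $M\subseteq A$, every upper bound of $M$ lies above some minimal upper bound of $M$, and every lower bound lies below some maximal lower bound. $\mathcal P_+(X)$ = nonempty subsets of $X$. For subsets $X,Y$: $X\le Y$ iff $x\le y$ for all $x\in X,y\in Y$; $X\le_1Y$ iff every $x\in X$ is below some $y\in Y$; $X\le_2Y$ iff every $y\in Y$ is above some $x\in X$. For $B\subseteq A^T$, $B(t)=\{q(t)\mid q\in B\}$. Elements $Z\in(\mathcal P_+A)^T$ are compared pointwise: $Z\le_i Z'$ means $Z(s)\le_i Z'(s)$ for all $s\in T$ (equivalently, comparison of $\prod_tZ(t)$ and $\prod_tZ'(t)$ in the componentwise order of $A^T$). The relation induced by $P,F,H,G$ is $R^*=\{(s,t)\in T^2\mid H(B)(t)\le B(s)\le P(B)(t)\text{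 and }G(B)(s)\le B(t)\le F(B)(s)\text{ for all }B\in\mathcal P_+(A^T)\}$. A relation $R$ on $T$ is serial if for each $s$ there are $r,t$ with $rRs$, $sRt$. For a time frame $(T,R)$ with $R$ serial, the induced tense operators are given for $B\in\mathcal P_+(A^T)$, $s\in T$ by $P(B)(s)=\operatorname{Min}U(\{q(t)\mid q\in B, tRs\})$, $F(B)(s)=\operatorname{Min}U(\{q(t)\mid q\in B, sRt\})$, $H(B)(s)=\operatorname{Max}L(\{q(t)\mid q\in B, tRs\})$, $G(B)(s)=\operatorname{Max}L(\{q(t)\mid q\in B, sRt\})$. -}

module Defs where

open import Level using (Level; _⊔_; suc)
open import Data.Product using (Σ; ∃; _×_; _,_)
open import Relation.Unary using (Pred)
open import Relation.Binary.Bundles using (Poset)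

module _ {c ℓ₁ ℓ₂ : Level} (𝐀 : Poset c ℓ₁ ℓ₂) where
  open Poset 𝐀 renaming (Carrier to A)

  L : ∀ {p} → Pred A p → Pred A (c ⊔ ℓ₂ ⊔ p)
  L X a = ∀ x → X x → a ≤ x

  U : ∀ {p} → Pred A p → Pred A (c ⊔ ℓ₂ ⊔ p)
  U X a = ∀ x → X x → x ≤ a

  Max : ∀ {p} → Pred A p → Pred A (c ⊔ ℓ₁ ⊔ ℓ₂ ⊔ p)
  Max X a = X a × (∀ b → X b → a ≤ b → a ≈ b)

  Min : ∀ {p} → Pred A p → Pred A (c ⊔ ℓ₁ ⊔ ℓ₂ ⊔ p)
  Min X a = X a × (∀ b → X b → b ≤ a → a ≈ b)

  IsBounded : A → A → Set (c ⊔ ℓ₂)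
  IsBounded 𝟎 𝟏 = ∀ x → (𝟎 ≤ x) × (x ≤ 𝟏)

  MLUB-complete : (p : Level) → Set (c ⊔ ℓ₁ ⊔ ℓ₂ ⊔ suc p)
  MLUB-complete p = (M : Pred A p) → ∃ M →
      (∀ u → U M u → Σ A (λ m → Min (U M) m × m ≤ u))
    × (∀ l → L M l → Σ A (λ m → Max (L M) m × l ≤ m))

  _≤ˢ_ : ∀ {p q} → Pred A p → Pred A q → Set (c ⊔ ℓ₂ ⊔ p ⊔ q)
  X ≤ˢ Y = ∀ x y → X x → Y y → x ≤ y

  _≤₁_ : ∀ {p q} → Pred A p → Pred A q → Set (c ⊔ ℓ₂ ⊔ p ⊔ q)
  X ≤₁ Y = ∀ x → X x → Σ A (λ y → Y y × x ≤ y)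

  _≤₂_ : ∀ {p q} → Pred A p → Pred A q → Set (c ⊔ ℓ₂ ⊔ p ⊔ q)
  X ≤₂ Y = ∀ y → Y y → Σ A (λ x → X x × x ≤ y)

record 𝒫₊ {a : Level} (X : Set a) (p : Level) : Set (a ⊔ suc p) where
  constructor mk𝒫₊
  field
    set      : Pred X p
    nonempty : ∃ set
open 𝒫₊ public

module Tense {c ℓ₁ ℓ₂ t : Level} (𝐀 : Poset c ℓ₁ ℓ₂) (T : Set t) where
  open Poset 𝐀 renaming (Carrier to A)

  eval : ∀ {p} → Pred (T → A) p → T → Pred A (c ⊔ ℓ₁ ⊔ t ⊔ p)
  eval B s a = Σ (T → A) (λ q → B q × q s ≈ a)

  Op : (p : Level) → Set (c ⊔ t ⊔ suc p)
  Op p = 𝒫₊ (T → A) p → T → 𝒫₊ A p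

  _≤₁ᵀ_ : ∀ {p q} → (T → Pred A p) → (T → Pred A q) → Set (c ⊔ ℓ₂ ⊔ t ⊔ p ⊔ q)
  Z ≤₁ᵀ Z' = ∀ s → _≤₁_ 𝐀 (Z s) (Z' s)

  _≤₂ᵀ_ : ∀ {p q} → (T → Pred A p) → (T → Pred A q) → Set (c ⊔ ℓ₂ ⊔ t ⊔ p ⊔ q)
  Z ≤₂ᵀ Z' = ∀ s → _≤₂_ 𝐀 (Z s) (Z' s)

  R* : ∀ {p} → (P F H G : Op p) → T → T → Set (c ⊔ ℓ₁ ⊔ ℓ₂ ⊔ t ⊔ suc p)
  R* P F H G s u = (B : 𝒫₊ (T → A) _) →
      _≤ˢ_ 𝐀 (set (H B u)) (eval (set B) s) × _≤ˢ_ 𝐀 (eval (set B) s) (set (P B u))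
    × _≤ˢ_ 𝐀 (set (G B s)) (eval (set B) u) × _≤ˢ_ 𝐀 (eval (set B) u) (set (F B s))

  Serial : ∀ {r} → (T → T → Set r) → Set (t ⊔ r)
  Serial R = ∀ s → Σ T (λ r → R r s) × Σ T (λ u → R s u)

  past : ∀ {p r} → (T → T → Set r) → Pred (T → A) p → T → Pred A (c ⊔ ℓ₁ ⊔ t ⊔ p ⊔ r)
  past R B s a = Σ T (λ u → R u s × eval B u a)

  future : ∀ {p r} → (T → T → Set r) → Pred (T → A) p → T → Pred A (c ⊔ ℓ₁ ⊔ t ⊔ p ⊔ r)
  future R B s a = Σ T (λ u → R s u × eval B u a)

  Pᴿ Fᴿ Hᴿ Gᴿ : ∀ {p r} → (T → T → Set r) → 𝒫₊ (T → A) p → T → Pred A (c ⊔ ℓ₁ ⊔ ℓ₂ ⊔ t ⊔ p ⊔ r)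
  Pᴿ R B s = Min 𝐀 (U 𝐀 (past R (set B) s))
  Fᴿ R B s = Min 𝐀 (U 𝐀 (future R (set B) s))
  Hᴿ R B s = Max 𝐀 (L 𝐀 (past R (set B) s))
  Gᴿ R B s = Max 𝐀 (L 𝐀 (future R (set B) s))

{-# OPTIONS --safe #-}
module Submission where

-- By the very definition of R*, whenever u R* s every element of P(B)(s) is
-- an upper bound of B(u) and every element of H(B)(s) a lower bound of it;
-- so P(B)(s) consists of upper bounds and H(B)(s) of lower bounds of the past
-- values {q(u) | q ∈ B, u R* s}, and dually for F, G and the future values.
-- Seriality makes these value sets nonempty, and MLUB-completeness then puts
-- a minimal upper bound below (a maximal lower bound above) each such bound.

open import Defs
open import Level using (Level)
open import Data.Product using (_×_; _,_; proj₁; proj₂)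
open import Relation.Unary using (Pred; _⊆_; Satisfiable)
open import Relation.Binary.Bundles using (Poset)

module _ {c ℓ₁ ℓ₂ : Level} (𝐀 : Poset c ℓ₁ ℓ₂) where
  open Poset 𝐀 renaming (Carrier to A)

  Min-U-≤₂ : ∀ {p q} {X : Pred A p} {Y : Pred A q} → MLUB-complete 𝐀 p
           → Satisfiable X → Y ⊆ U 𝐀 X → _≤₂_ 𝐀 (Min 𝐀 (U 𝐀 X)) Y
  Min-U-≤₂ mlub X-ne Y⊆UX y y∈Y = proj₁ (mlub _ X-ne) y (Y⊆UX y∈Y)

  ≤₁-Max-L : ∀ {p q} {X : Pred A p} {Y : Pred A q} → MLUB-complete 𝐀 p
           → Satisfiable X → Y ⊆ L 𝐀 X → _≤₁_ 𝐀 Y (Max 𝐀 (L 𝐀 X))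
  ≤₁-Max-L mlub X-ne Y⊆LX y y∈Y = proj₂ (mlub _ X-ne) y (Y⊆LX y∈Y)

module _ {c ℓ₁ ℓ₂ t : Level} (𝐀 : Poset c ℓ₁ ℓ₂) (T : Set t) where
  open Poset 𝐀 renaming (Carrier to A)
  open Tense 𝐀 T

  module _ {p r : Level} {R : T → T → Set r} (serial : Serial R) (B : 𝒫₊ (T → A) p) where

    past-satisfiable : ∀ s → Satisfiable (past R (set B) s)
    past-satisfiable s =
      let (u , uRs) = proj₁ (serial s) ; (q , q∈B) = nonempty B
      in q u , u , uRs , q , q∈B , Eq.refl

    future-satisfiable : ∀ s → Satisfiable (future R (set B) s)
    future-satisfiable s =
      let (u , sRu) = proj₂ (serial s) ; (q , q∈B) = nonempty B
      in q u , u , sRu , q , q∈B , Eq.refl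

  module _ {p : Level} (P F H G : Op p) (B : 𝒫₊ (T → A) p) (s : T) where

    P-⊆-U-past : set (P B s) ⊆ U 𝐀 (past (R* P F H G) (set B) s)
    P-⊆-U-past {y} y∈P a (u , uRs , a∈Bu) = let (_ , Bu≤P , _) = uRs B in Bu≤P a y a∈Bu y∈P

    H-⊆-L-past : set (H B s) ⊆ L 𝐀 (past (R* P F H G) (set B) s)
    H-⊆-L-past {x} x∈H a (u , uRs , a∈Bu) = let (H≤Bu , _) = uRs B in H≤Bu x a x∈H a∈Bu

    F-⊆-U-future : set (F B s) ⊆ U 𝐀 (future (R* P F H G) (set B) s)
    F-⊆-U-future {y} y∈F a (u , sRu , a∈Bu) = let (_ , _ , _ , Bu≤F) = sRu B in Bu≤F a y a∈Bu y∈F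

    G-⊆-L-future : set (G B s) ⊆ L 𝐀 (future (R* P F H G) (set B) s)
    G-⊆-L-future {x} x∈G a (u , sRu , a∈Bu) = let (_ , _ , G≤Bu , _) = sRu B in G≤Bu x a x∈G a∈Bu

theorem5p2 : ∀ {c ℓ₁ ℓ₂ t p : Level} (𝐀 : Poset c ℓ₁ ℓ₂) (𝟎 𝟏 : Poset.Carrier 𝐀)
    → IsBounded 𝐀 𝟎 𝟏
    → (∀ {q : Level} → MLUB-complete 𝐀 q)
    → (T : Set t) → T
    → (P F H G : Tense.Op 𝐀 T p)
    → Tense.Serial 𝐀 T (Tense.R* 𝐀 T P F H G)
    → (B : 𝒫₊ (T → Poset.Carrier 𝐀) p)
    → Tense._≤₂ᵀ_ 𝐀 T (Tense.Pᴿ 𝐀 T (Tense.R* 𝐀 T P F H G) B) (λ s → set (P B s))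
    × Tense._≤₂ᵀ_ 𝐀 T (Tense.Fᴿ 𝐀 T (Tense.R* 𝐀 T P F H G) B) (λ s → set (F B s))
    × Tense._≤₁ᵀ_ 𝐀 T (λ s → set (H B s)) (Tense.Hᴿ 𝐀 T (Tense.R* 𝐀 T P F H G) B)
    × Tense._≤₁ᵀ_ 𝐀 T (λ s → set (G B s)) (Tense.Gᴿ 𝐀 T (Tense.R* 𝐀 T P F H G) B)
theorem5p2 𝐀 _ _ _ mlub T _ P F H G serial B =
    (λ s → Min-U-≤₂ 𝐀 mlub (past-satisfiable 𝐀 T serial B s) (P-⊆-U-past 𝐀 T P F H G B s))
  , (λ s → Min-U-≤₂ 𝐀 mlub (future-satisfiable 𝐀 T serial B s) (F-⊆-U-future 𝐀 T P F H G B s))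
  , (λ s → ≤₁-Max-L 𝐀 mlub (past-satisfiable 𝐀 T serial B s) (H-⊆-L-past 𝐀 T P F H G B s))
  , (λ s → ≤₁-Max-L 𝐀 mlub (future-satisfiable 𝐀 T serial B s) (G-⊆-L-future 𝐀 T P F H G B s))
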